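{- Let $a,b$ be nonzero real numbers and let \[ Q_{l}=\begin{pmatrix} a^{2}+\frac{2a}{b} & \frac{a^{2}}{b} \\ a & \frac{2a}{b}\end{pmatrix}. \] Then for every positive integer $n$, \[ Q_{l}^{n}=\begin{cases} \left(\frac{a}{b}\right)^{n}(ab+4)^{\frac{n}{2}}\begin{pmatrix} q_{n+1} & q_{n} \\ \frac{b}{a}q_{n} & q_{n-1}\end{pmatrix}, & n \text{ even},\\[2mm] \left(\frac{a}{b}\right)^{n}(ab+4)^{\frac{n-1}{2}}\begin{pmatrix} l_{n+1} & l_{n} \\ \frac{b}{a}l_{n} & l_{n-1}\end{pmatrix}, & n \text{ odd}, \end{cases} \] where $q_n$ and $l_n$ are the $n$th bi-periodic Fibonacci and bi-periodic Lucas numbers with parameters $a,b$.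
   Context: The bi-periodic Fibonacci sequence $(q_n)_{n\ge 0}$ is defined by $q_0=0$, $q_1=1$, and $q_n=aq_{n-1}+q_{n-2}$ if $n$ is even, $q_n=bq_{n-1}+q_{n-2}$ if $n$ is odd ($n\ge 2$). The bi-periodic Lucas sequence $(l_n)_{n\ge 0}$ is defined by $l_0=2$, $l_1=a$, and $l_n=bl_{n-1}+l_{n-2}$ if $n$ is even, $l_n=al_{n-1}+l_{n-2}$ if $n$ is odd ($n\ge 2$). Here $a,b$ are nonzero real numbers. -}

module Defs where

open import Level using (Level)
open import Data.Nat using (ℕ; zero; suc)
open import Data.Product using (proj₁)
open import Data.Product using (_×_)
open import Algebra.Apartness.Bundles using (HeytingField)

-- Definitions over an arbitrary Heyting (constructive) field F, e.g. the reals.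
module BiPeriodic {c ℓ₁ ℓ₂ : Level} (F : HeytingField c ℓ₁ ℓ₂) where
  open HeytingField F

  inv : (x : Carrier) → x # 0# → Carrier
  inv x p = proj₁ (#⇒invertible p)

  _^_ : Carrier → ℕ → Carrier
  x ^ zero = 1#
  x ^ suc n = x * (x ^ n)

  2# 4# : Carrier
  2# = 1# + 1#
  4# = 2# + 2#

  ifEven : ℕ → Carrier → Carrier → Carrier
  ifEven zero x y = x
  ifEven (suc zero) x y = y
  ifEven (suc (suc n)) x y = ifEven n x y

  -- bi-periodic Fibonacci: q0 = 0, q1 = 1,
  -- q n = a q(n-1) + q(n-2) for n even, b q(n-1) + q(n-2) for n odd
  q : Carrier → Carrier → ℕ → Carrier
  q a b zero = 0#
  q a b (suc zero) = 1#
  q a b (suc (suc n)) = ifEven n a b * q a b (suc n) + q a b n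

  -- bi-periodic Lucas: l0 = 2, l1 = a,
  -- l n = b l(n-1) + l(n-2) for n even, a l(n-1) + l(n-2) for n odd
  l : Carrier → Carrier → ℕ → Carrier
  l a b zero = 2#
  l a b (suc zero) = a
  l a b (suc (suc n)) = ifEven n b a * l a b (suc n) + l a b n

  record M2 : Set c where
    constructor mat
    field
      e11 e12 e21 e22 : Carrier
  open M2 public

  _≈M_ : M2 → M2 → Set ℓ₁
  A ≈M B = (e11 A ≈ e11 B) × (e12 A ≈ e12 B) × (e21 A ≈ e21 B) × (e22 A ≈ e22 B)

  _⊗_ : M2 → M2 → M2
  A ⊗ B = mat (e11 A * e11 B + e12 A * e21 B) (e11 A * e12 B + e12 A * e22 B)
              (e21 A * e11 B + e22 A * e21 B) (e21 A * e12 B + e22 A * e22 B)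

  I2 : M2
  I2 = mat 1# 0# 0# 1#

  _⊙_ : Carrier → M2 → M2
  s ⊙ A = mat (s * e11 A) (s * e12 A) (s * e21 A) (s * e22 A)

  _^M_ : M2 → ℕ → M2
  A ^M zero = I2
  A ^M suc n = (A ^M n) ⊗ A

-- Write Ql = (a/b) P with P = ( ab+2  a ; b  2 ).  Then P² = (ab+4) M with
-- M = ( ab+1  a ; b  1 ), and right multiplication by M sends the matrix
-- ( x(n+1)  x(n) ; (b/a) x(n)  x(n-1) ) of a sequence x to the same matrix at n + 2
-- whenever x(j) = c x(j-1) + x(j-2) holds with c = b for j = n+1, n+3 and c = a for
-- j = n+2.  The Fibonacci numbers q satisfy this for even n, the Lucas numbers l for
-- odd n, so the formula follows by induction in steps of two from P¹ and P².
module Submission where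

open import Defs
open import Data.Nat using (ℕ; _≤_; _∸_; ⌊_/2⌋; suc)
open import Data.Nat.Divisibility using (_∣_)
open import Relation.Nullary using (¬_)
open import Data.Product using (_×_)
open import Algebra.Apartness.Bundles using (HeytingField)

open import Data.Nat using (zero; s≤s)
import Data.Nat as ℕ
open import Data.Nat.Divisibility using (divides; ∣-refl; ∣m∣n⇒∣m+n)
open import Data.Product using (Σ; _,_; proj₂)
open import Data.Empty using (⊥-elim)
open import Data.Maybe using (Maybe; just; nothing)
open import Relation.Nullary using (yes; no)
open import Relation.Binary.Bundles using (Setoid)
open import Relation.Binary.Structures using (IsEquivalence)
import Relation.Binary.PropositionalEquality as ≡
import Relation.Binary.Reasoning.Setoid as SetoidReasoning
open import Algebra.Apartness.Bundles using (HeytingCommutativeRing)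
open import Algebra.Bundles using (CommutativeRing)

¬2∣n⇒n≡1+k*2 : ∀ n → ¬ 2 ∣ n → Σ ℕ λ k → n ≡.≡ suc (k ℕ.* 2)
¬2∣n⇒n≡1+k*2 zero 2∤0 = ⊥-elim (2∤0 (divides 0 ≡.refl))
¬2∣n⇒n≡1+k*2 (suc zero) _ = 0 , ≡.refl
¬2∣n⇒n≡1+k*2 (suc (suc n)) 2∤2+n with ¬2∣n⇒n≡1+k*2 n (λ 2∣n → 2∤2+n (∣m∣n⇒∣m+n ∣-refl 2∣n))
... | k , ≡.refl = suc k , ≡.refl

module BiPeriodicMatrices {c ℓ₁ ℓ₂} (F : HeytingField c ℓ₁ ℓ₂) where
  open HeytingField F hiding (zero)
  open BiPeriodic F
  open CommutativeRing (HeytingCommutativeRing.commutativeRing heytingCommutativeRing)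
    using (+-group; commutativeSemiring; semiring)
  open import Algebra.Properties.Group +-group using (ε⁻¹≈ε)
  open import Algebra.Properties.Semiring.Mult semiring using () renaming (_×_ to _×ₙ_)

  ×ₙ-1#-≟ : ∀ m n → Maybe (m ×ₙ 1# ≈ n ×ₙ 1#)
  ×ₙ-1#-≟ m n with m ℕ.≟ n
  ... | yes ≡.refl = just refl
  ... | no _ = nothing

  open import Algebra.Solver.Ring.NaturalCoefficients commutativeSemiring ×ₙ-1#-≟
    using (solve; _:+_; _:*_; con; _:=_)
  module ≈-Reasoning = SetoidReasoning setoid

  ifEven-even : ∀ k (x y : Carrier) → ifEven (k ℕ.* 2) x y ≡.≡ x
  ifEven-even zero x y = ≡.refl
  ifEven-even (suc k) x y = ifEven-even k x y

  ifEven-odd : ∀ k (x y : Carrier) → ifEven (suc (k ℕ.* 2)) x y ≡.≡ y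
  ifEven-odd zero x y = ≡.refl
  ifEven-odd (suc k) x y = ifEven-odd k x y

  x*x⁻¹≈1 : ∀ {x} (x#0 : x # 0#) → x * inv x x#0 ≈ 1#
  x*x⁻¹≈1 {x} x#0 = trans (*-congʳ x≈x-0#) (proj₂ (proj₂ (#⇒invertible x#0)))
    where
    x≈x-0# : x ≈ x - 0#
    x≈x-0# = sym (trans (+-congˡ ε⁻¹≈ε) (+-identityʳ x))

  ≈M-isEquivalence : IsEquivalence _≈M_
  ≈M-isEquivalence = record
    { refl = refl , refl , refl , refl
    ; sym = λ (p₁ , p₂ , p₃ , p₄) → sym p₁ , sym p₂ , sym p₃ , sym p₄
    ; trans = λ (p₁ , p₂ , p₃ , p₄) (r₁ , r₂ , r₃ , r₄) →
        trans p₁ r₁ , trans p₂ r₂ , trans p₃ r₃ , trans p₄ r₄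
    }

  M2-setoid : Setoid c ℓ₁
  M2-setoid = record { isEquivalence = ≈M-isEquivalence }

  module ≈M-Reasoning = SetoidReasoning M2-setoid
  open IsEquivalence ≈M-isEquivalence using () renaming (refl to ≈M-refl)

  ⊗-cong : ∀ {A A′ B B′} → A ≈M A′ → B ≈M B′ → (A ⊗ B) ≈M (A′ ⊗ B′)
  ⊗-cong (p₁₁ , p₁₂ , p₂₁ , p₂₂) (r₁₁ , r₁₂ , r₂₁ , r₂₂) =
    +-cong (*-cong p₁₁ r₁₁) (*-cong p₁₂ r₂₁) , +-cong (*-cong p₁₁ r₁₂) (*-cong p₁₂ r₂₂) ,
    +-cong (*-cong p₂₁ r₁₁) (*-cong p₂₂ r₂₁) , +-cong (*-cong p₂₁ r₁₂) (*-cong p₂₂ r₂₂)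

  ⊙-cong : ∀ {s r A B} → s ≈ r → A ≈M B → (s ⊙ A) ≈M (r ⊙ B)
  ⊙-cong s≈r (p₁₁ , p₁₂ , p₂₁ , p₂₂) = *-cong s≈r p₁₁ , *-cong s≈r p₁₂ , *-cong s≈r p₂₁ , *-cong s≈r p₂₂

  ⊗-assoc : ∀ A B C → ((A ⊗ B) ⊗ C) ≈M (A ⊗ (B ⊗ C))
  ⊗-assoc (mat a₁₁ a₁₂ a₂₁ a₂₂) (mat b₁₁ b₁₂ b₂₁ b₂₂) (mat c₁₁ c₁₂ c₂₁ c₂₂) =
    entry a₁₁ a₁₂ c₁₁ c₂₁ , entry a₁₁ a₁₂ c₁₂ c₂₂ , entry a₂₁ a₂₂ c₁₁ c₂₁ , entry a₂₁ a₂₂ c₁₂ c₂₂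
    where
    entry : ∀ x₁ x₂ z₁ z₂ →
      (x₁ * b₁₁ + x₂ * b₂₁) * z₁ + (x₁ * b₁₂ + x₂ * b₂₂) * z₂
        ≈ x₁ * (b₁₁ * z₁ + b₁₂ * z₂) + x₂ * (b₂₁ * z₁ + b₂₂ * z₂)
    entry x₁ x₂ z₁ z₂ = solve 8 (λ x₁ x₂ z₁ z₂ b₁₁ b₁₂ b₂₁ b₂₂ →
      (x₁ :* b₁₁ :+ x₂ :* b₂₁) :* z₁ :+ (x₁ :* b₁₂ :+ x₂ :* b₂₂) :* z₂
        := x₁ :* (b₁₁ :* z₁ :+ b₁₂ :* z₂) :+ x₂ :* (b₂₁ :* z₁ :+ b₂₂ :* z₂))
      refl x₁ x₂ z₁ z₂ b₁₁ b₁₂ b₂₁ b₂₂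

  ⊙-⊗-⊙ : ∀ s r A B → ((s ⊙ A) ⊗ (r ⊙ B)) ≈M ((s * r) ⊙ (A ⊗ B))
  ⊙-⊗-⊙ s r (mat a₁₁ a₁₂ a₂₁ a₂₂) (mat b₁₁ b₁₂ b₂₁ b₂₂) =
    entry a₁₁ b₁₁ a₁₂ b₂₁ , entry a₁₁ b₁₂ a₁₂ b₂₂ , entry a₂₁ b₁₁ a₂₂ b₂₁ , entry a₂₁ b₁₂ a₂₂ b₂₂
    where
    entry : ∀ x₁ y₁ x₂ y₂ → (s * x₁) * (r * y₁) + (s * x₂) * (r * y₂) ≈ (s * r) * (x₁ * y₁ + x₂ * y₂)
    entry = solve 6 (λ s r x₁ y₁ x₂ y₂ →
      (s :* x₁) :* (r :* y₁) :+ (s :* x₂) :* (r :* y₂) := (s :* r) :* (x₁ :* y₁ :+ x₂ :* y₂)) refl s r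

  ⊙-assoc : ∀ s r A → (s ⊙ (r ⊙ A)) ≈M ((s * r) ⊙ A)
  ⊙-assoc s r A = sym (*-assoc s r _) , sym (*-assoc s r _) , sym (*-assoc s r _) , sym (*-assoc s r _)

  ^M-cong : ∀ {A B} n → A ≈M B → (A ^M n) ≈M (B ^M n)
  ^M-cong zero A≈B = ≈M-refl
  ^M-cong (suc n) A≈B = ⊗-cong (^M-cong n A≈B) A≈B

  ⊙-^M : ∀ s A n → ((s ⊙ A) ^M n) ≈M ((s ^ n) ⊙ (A ^M n))
  ⊙-^M s A zero = sym (*-identityˡ 1#) , sym (*-identityˡ 0#) , sym (*-identityˡ 0#) , sym (*-identityˡ 1#)
  ⊙-^M s A (suc n) = begin
    ((s ⊙ A) ^M n) ⊗ (s ⊙ A)        ≈⟨ ⊗-cong (⊙-^M s A n) ≈M-refl ⟩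
    ((s ^ n) ⊙ (A ^M n)) ⊗ (s ⊙ A)  ≈⟨ ⊙-⊗-⊙ (s ^ n) s (A ^M n) A ⟩
    (s ^ n * s) ⊙ ((A ^M n) ⊗ A)    ≈⟨ ⊙-cong (*-comm (s ^ n) s) ≈M-refl ⟩
    (s ^ suc n) ⊙ (A ^M suc n)      ∎
    where open ≈M-Reasoning

  ^M-of-scaled : ∀ {A B X} t s n → A ≈M (t ⊙ B) → (B ^M n) ≈M (s ⊙ X) → (A ^M n) ≈M ((t ^ n * s) ⊙ X)
  ^M-of-scaled {A} {B} {X} t s n A≈tB Bⁿ≈sX = begin
    A ^M n              ≈⟨ ^M-cong n A≈tB ⟩
    (t ⊙ B) ^M n        ≈⟨ ⊙-^M t B n ⟩
    (t ^ n) ⊙ (B ^M n)  ≈⟨ ⊙-cong refl Bⁿ≈sX ⟩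
    (t ^ n) ⊙ (s ⊙ X)   ≈⟨ ⊙-assoc (t ^ n) s X ⟩
    (t ^ n * s) ⊙ X     ∎
    where open ≈M-Reasoning

  module PowersOfP (a b γ : Carrier) (γa≈b : γ * a ≈ b) where

    u : Carrier
    u = a * b + 4#

    P M : M2
    P = mat (a * b + 2#) a b 2#
    M = mat (a * b + 1#) a b 1#

    -- γ stands for b/a: only γ * a ≈ b is used.  The index n ∸ 1 is truncated at n = 0.
    seqMatrix : (ℕ → Carrier) → ℕ → M2
    seqMatrix x n = mat (x (suc n)) (x n) (γ * x n) (x (n ∸ 1))

    Recurrence : (ℕ → Carrier) → Carrier → ℕ → Set ℓ₁
    Recurrence x κ m = x (suc (suc m)) ≈ κ * x (suc m) + x m

    q-recurrence-even : ∀ k → Recurrence (q a b) a (k ℕ.* 2)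
    q-recurrence-even k = ≡.subst (λ e → Recurrence (q a b) e (k ℕ.* 2)) (ifEven-even k a b) refl

    q-recurrence-odd : ∀ k → Recurrence (q a b) b (suc (k ℕ.* 2))
    q-recurrence-odd k = ≡.subst (λ e → Recurrence (q a b) e (suc (k ℕ.* 2))) (ifEven-odd k a b) refl

    l-recurrence-even : ∀ k → Recurrence (l a b) b (k ℕ.* 2)
    l-recurrence-even k = ≡.subst (λ e → Recurrence (l a b) e (k ℕ.* 2)) (ifEven-even k b a) refl

    l-recurrence-odd : ∀ k → Recurrence (l a b) a (suc (k ℕ.* 2))
    l-recurrence-odd k = ≡.subst (λ e → Recurrence (l a b) e (suc (k ℕ.* 2))) (ifEven-odd k b a) refl

    seqMatrix-⊗-M : ∀ x m → Recurrence x b m → Recurrence x a (suc m) → Recurrence x b (suc (suc m)) →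
                    (seqMatrix x (suc m) ⊗ M) ≈M seqMatrix x (suc (suc (suc m)))
    seqMatrix-⊗-M x m r₀ r₁ r₂ = e₁₁ , e₁₂ , e₂₁ , e₂₂
      where
      open ≈-Reasoning
      x₀ x₁ x₂ x₃ : Carrier
      x₀ = x m
      x₁ = x (suc m)
      x₂ = x (suc (suc m))
      x₃ = x (suc (suc (suc m)))

      e₁₁ : x₂ * (a * b + 1#) + x₁ * b ≈ x (suc (suc (suc (suc m))))
      e₁₁ = sym (begin
        x (suc (suc (suc (suc m)))) ≈⟨ r₂ ⟩
        b * x₃ + x₂                 ≈⟨ +-congʳ (*-congˡ r₁) ⟩
        b * (a * x₂ + x₁) + x₂      ≈⟨ solve 4 (λ a b x₁ x₂ →
                                         b :* (a :* x₂ :+ x₁) :+ x₂ := x₂ :* (a :* b :+ con 1) :+ x₁ :* b)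
                                       refl a b x₁ x₂ ⟩
        x₂ * (a * b + 1#) + x₁ * b  ∎)

      e₁₂ : x₂ * a + x₁ * 1# ≈ x₃
      e₁₂ = sym (trans r₁ (solve 3 (λ a x₁ x₂ → a :* x₂ :+ x₁ := x₂ :* a :+ x₁ :* con 1) refl a x₁ x₂))

      e₂₁ : γ * x₁ * (a * b + 1#) + x₀ * b ≈ γ * x₃
      e₂₁ = begin
        γ * x₁ * (a * b + 1#) + x₀ * b        ≈⟨ +-congˡ (*-congˡ γa≈b) ⟨
        γ * x₁ * (a * b + 1#) + x₀ * (γ * a)  ≈⟨ solve 5 (λ a b γ x₀ x₁ →
            γ :* x₁ :* (a :* b :+ con 1) :+ x₀ :* (γ :* a) := γ :* (a :* (b :* x₁ :+ x₀) :+ x₁))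
            refl a b γ x₀ x₁ ⟩
        γ * (a * (b * x₁ + x₀) + x₁)          ≈⟨ *-congˡ (+-congʳ (*-congˡ r₀)) ⟨
        γ * (a * x₂ + x₁)                     ≈⟨ *-congˡ r₁ ⟨
        γ * x₃                                ∎

      e₂₂ : γ * x₁ * a + x₀ * 1# ≈ x₂
      e₂₂ = begin
        γ * x₁ * a + x₀ * 1#    ≈⟨ solve 4 (λ a γ x₀ x₁ → γ :* x₁ :* a :+ x₀ :* con 1 := γ :* a :* x₁ :+ x₀)
                                     refl a γ x₀ x₁ ⟩
        γ * a * x₁ + x₀         ≈⟨ +-congʳ (*-congʳ γa≈b) ⟩
        b * x₁ + x₀             ≈⟨ r₀ ⟨
        x₂                      ∎

    P⊗P≈u⊙M : (P ⊗ P) ≈M (u ⊙ M)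
    P⊗P≈u⊙M =
      solve 2 (λ a b → (a :* b :+ con 2) :* (a :* b :+ con 2) :+ a :* b
                         := (a :* b :+ (con 2 :+ con 2)) :* (a :* b :+ con 1)) refl a b ,
      solve 2 (λ a b → (a :* b :+ con 2) :* a :+ a :* con 2 := (a :* b :+ (con 2 :+ con 2)) :* a) refl a b ,
      solve 2 (λ a b → b :* (a :* b :+ con 2) :+ con 2 :* b := (a :* b :+ (con 2 :+ con 2)) :* b) refl a b ,
      solve 2 (λ a b → b :* a :+ con 2 :* con 2 := (a :* b :+ (con 2 :+ con 2)) :* con 1) refl a b

    power-step : ∀ x m → Recurrence x b m → Recurrence x a (suc m) → Recurrence x b (suc (suc m)) →
                 (P ^M suc m) ≈M ((u ^ ⌊ suc m /2⌋) ⊙ seqMatrix x (suc m)) →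
                 (P ^M suc (suc (suc m))) ≈M ((u ^ ⌊ suc (suc (suc m)) /2⌋) ⊙ seqMatrix x (suc (suc (suc m))))
    power-step x m r₀ r₁ r₂ Pⁿ≈ = begin
      ((Pⁿ ⊗ P) ⊗ P)           ≈⟨ ⊗-assoc Pⁿ P P ⟩
      Pⁿ ⊗ (P ⊗ P)             ≈⟨ ⊗-cong Pⁿ≈ P⊗P≈u⊙M ⟩
      (s ⊙ X) ⊗ (u ⊙ M)        ≈⟨ ⊙-⊗-⊙ s u X M ⟩
      (s * u) ⊙ (X ⊗ M)        ≈⟨ ⊙-cong (*-comm s u) (seqMatrix-⊗-M x m r₀ r₁ r₂) ⟩
      (u * s) ⊙ seqMatrix x (suc (suc (suc m))) ∎
      where
      open ≈M-Reasoning
      Pⁿ X : M2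
      Pⁿ = P ^M suc m
      X = seqMatrix x (suc m)
      s : Carrier
      s = u ^ ⌊ suc m /2⌋

    odd-powers : ∀ k → (P ^M suc (k ℕ.* 2)) ≈M ((u ^ ⌊ suc (k ℕ.* 2) /2⌋) ⊙ seqMatrix (l a b) (suc (k ℕ.* 2)))
    odd-powers zero =
      solve 2 (λ a b → con 1 :* (a :* b :+ con 2) :+ con 0 :* b := con 1 :* (b :* a :+ con 2)) refl a b ,
      solve 1 (λ a → con 1 :* a :+ con 0 :* con 2 := con 1 :* a) refl a ,
      trans (solve 2 (λ a b → con 0 :* (a :* b :+ con 2) :+ con 1 :* b := con 1 :* b) refl a b)
            (*-congˡ (sym γa≈b)) ,
      solve 1 (λ a → con 0 :* a :+ con 1 :* con 2 := con 1 :* con 2) refl a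
    odd-powers (suc k) = power-step (l a b) (k ℕ.* 2)
      (l-recurrence-even k) (l-recurrence-odd k) (l-recurrence-even (suc k)) (odd-powers k)

    even-powers : ∀ k → (P ^M suc (suc (k ℕ.* 2))) ≈M
                        ((u ^ ⌊ suc (suc (k ℕ.* 2)) /2⌋) ⊙ seqMatrix (q a b) (suc (suc (k ℕ.* 2))))
    even-powers zero = begin
      ((I2 ⊗ P) ⊗ P)      ≈⟨ ⊗-cong I2⊗P≈P ≈M-refl ⟩
      P ⊗ P               ≈⟨ P⊗P≈u⊙M ⟩
      u ⊙ M               ≈⟨ ⊙-cong (sym (*-identityʳ u)) M≈seqMatrix-q-2 ⟩
      (u * 1#) ⊙ seqMatrix (q a b) 2 ∎
      where
      open ≈M-Reasoning
      I2⊗P≈P : (I2 ⊗ P) ≈M P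
      I2⊗P≈P =
        solve 2 (λ a b → con 1 :* (a :* b :+ con 2) :+ con 0 :* b := a :* b :+ con 2) refl a b ,
        solve 1 (λ a → con 1 :* a :+ con 0 :* con 2 := a) refl a ,
        solve 2 (λ a b → con 0 :* (a :* b :+ con 2) :+ con 1 :* b := b) refl a b ,
        solve 1 (λ a → con 0 :* a :+ con 1 :* con 2 := con 2) refl a
      M≈seqMatrix-q-2 : M ≈M seqMatrix (q a b) 2
      M≈seqMatrix-q-2 =
        solve 2 (λ a b → a :* b :+ con 1 := b :* (a :* con 1 :+ con 0) :+ con 1) refl a b ,
        solve 1 (λ a → a := a :* con 1 :+ con 0) refl a ,
        trans (sym γa≈b) (*-congˡ (solve 1 (λ a → a := a :* con 1 :+ con 0) refl a)) ,
        refl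
    even-powers (suc k) = power-step (q a b) (suc (k ℕ.* 2))
      (q-recurrence-odd k) (q-recurrence-even (suc k)) (q-recurrence-odd (suc k)) (even-powers k)

  module PowersOfQl (a b : Carrier) (a#0 : a # 0#) (b#0 : b # 0#) where
    a⁻¹ b⁻¹ : Carrier
    a⁻¹ = inv a a#0
    b⁻¹ = inv b b#0

    b*a⁻¹*a≈b : b * a⁻¹ * a ≈ b
    b*a⁻¹*a≈b = trans (*-assoc b a⁻¹ a) (trans (*-congˡ (trans (*-comm a⁻¹ a) (x*x⁻¹≈1 a#0))) (*-identityʳ b))

    open PowersOfP a b (b * a⁻¹) b*a⁻¹*a≈b

    Ql : M2
    Ql = mat (a ^ 2 + 2# * a * b⁻¹) (a ^ 2 * b⁻¹) a (2# * a * b⁻¹)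

    Ql≈a*b⁻¹⊙P : Ql ≈M ((a * b⁻¹) ⊙ P)
    Ql≈a*b⁻¹⊙P = e₁₁ ,
      solve 2 (λ a β → a :* (a :* con 1) :* β := a :* β :* a) refl a b⁻¹ ,
      e₂₁ ,
      solve 2 (λ a β → con 2 :* a :* β := a :* β :* con 2) refl a b⁻¹
      where
      open ≈-Reasoning
      e₁₁ : a ^ 2 + 2# * a * b⁻¹ ≈ a * b⁻¹ * (a * b + 2#)
      e₁₁ = begin
        a * (a * 1#) + 2# * a * b⁻¹        ≈⟨ +-congʳ (*-congˡ (*-congˡ (x*x⁻¹≈1 b#0))) ⟨
        a * (a * (b * b⁻¹)) + 2# * a * b⁻¹ ≈⟨ solve 3 (λ a b β →
            a :* (a :* (b :* β)) :+ con 2 :* a :* β := a :* β :* (a :* b :+ con 2)) refl a b b⁻¹ ⟩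
        a * b⁻¹ * (a * b + 2#)             ∎
      e₂₁ : a ≈ a * b⁻¹ * b
      e₂₁ = begin
        a                 ≈⟨ *-identityʳ a ⟨
        a * 1#            ≈⟨ *-congˡ (x*x⁻¹≈1 b#0) ⟨
        a * (b * b⁻¹)     ≈⟨ solve 3 (λ a b β → a :* (b :* β) := a :* β :* b) refl a b b⁻¹ ⟩
        a * b⁻¹ * b       ∎

    Ql-even-power : ∀ n → 1 ≤ n → 2 ∣ n →
                    (Ql ^M n) ≈M (((a * b⁻¹) ^ n * u ^ ⌊ n /2⌋) ⊙ seqMatrix (q a b) n)
    Ql-even-power n (s≤s _) (divides (suc k) ≡.refl) = ^M-of-scaled (a * b⁻¹) _ n Ql≈a*b⁻¹⊙P (even-powers k)

    Ql-odd-power : ∀ n → ¬ 2 ∣ n →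
                   (Ql ^M n) ≈M (((a * b⁻¹) ^ n * u ^ ⌊ n /2⌋) ⊙ seqMatrix (l a b) n)
    Ql-odd-power n 2∤n with ¬2∣n⇒n≡1+k*2 n 2∤n
    ... | k , ≡.refl = ^M-of-scaled (a * b⁻¹) _ n Ql≈a*b⁻¹⊙P (odd-powers k)

theorem2 : ∀ {c ℓ₁ ℓ₂} (F : HeytingField c ℓ₁ ℓ₂) →
  let open HeytingField F
      open BiPeriodic F
  in (a b : Carrier) (a#0 : a # 0#) (b#0 : b # 0#) →
     let a⁻¹ = inv a a#0
         b⁻¹ = inv b b#0
         Ql = mat (a ^ 2 + 2# * a * b⁻¹) (a ^ 2 * b⁻¹) a (2# * a * b⁻¹)
     in (n : ℕ) → 1 ≤ n →
        (2 ∣ n → (Ql ^M n) ≈M (((a * b⁻¹) ^ n * (a * b + 4#) ^ ⌊ n /2⌋)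
                     ⊙ mat (q a b (suc n)) (q a b n) (b * a⁻¹ * q a b n) (q a b (n ∸ 1))))
        × (¬ (2 ∣ n) → (Ql ^M n) ≈M (((a * b⁻¹) ^ n * (a * b + 4#) ^ ⌊ n /2⌋)
                     ⊙ mat (l a b (suc n)) (l a b n) (b * a⁻¹ * l a b n) (l a b (n ∸ 1))))
theorem2 F a b a#0 b#0 n 1≤n = Ql-even-power n 1≤n , Ql-odd-power n
  where open BiPeriodicMatrices.PowersOfQl F a b a#0 b#0
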